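{- Let $K=(E,\lambda)$ and $K_0=(E_0,\lambda_0)$ be connectivity systems such that $K_0$ adheres to $K$. Then no tangle in $K$ splits in $K_0$: for every positive integer $k$ and every tangle $\mathcal{T}$ of order $k$ in $K$, there do not exist two distinct tangles of order $k$ in $K_0$ that both induce $\mathcal{T}$ in $K$.
   Context: A connectivity system is a pair $(E,\lambda)$ where $E$ is a finite set and $\lambda$ is a non-negative integer-valued function on subsets of $E$ such that $\lambda(X)=\lambda(E\setminus X)$ for all $X\subseteq E$ and $\lambda(X\cap Y)+\lambda(X\cup Y)\le\lambda(X)+\lambda(Y)$ for all $X,Y\subseteq E$. $\mathcal S_k(K)$ denotes the set of $X\subseteq E$ with $\lambda(X)<k$. A tangle of order $k$ in $K$ is a set $\mathcal{T}\subseteq\mathcal S_k(K)$ such that: for each $A\in\mathcal S_k(K)$ exactly one of $A$ and $E\setminus A$ lies in $\mathcal{T}$; there are no $T_1,T_2,T_3\in\mathcal{T}$ with $T_1\cup T_2\cup T_3=E$; and no set in $\mathcal{T}$ has size $|E|-1$. $K$ dominates $K_0$ if $E_0\subseteq E$ and $\lambda_0(X)\le\lambda(X)$ for all $X\subseteq E_0$. If $K$ dominates $K_0$ and $\mathcal{T}_0$ is a tangle of order $k$ in $K_0$, the tangle induced by $\mathcal{T}_0$ in $K$ is $\{X\in\mathcal S_k(K): X\cap E_0\in\mathcal{T}_0\}$. A tangle $\mathcal{T}$ of order $k$ in $K$ splits in $K_0$ if there are two distinct tangles of order $k$ in $K_0$ that both induce $\mathcal{T}$. $K_0$ adheres to $K$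 if $K$ dominates $K_0$ and for each partition $(A,B)$ of $E_0$ there is a partition $(X_1,X_2)$ of $A$ or of $B$ (one of $X_1,X_2$ may be empty) with $\lambda(X_1)\le\lambda_0(A)$ and $\lambda(X_2)\le\lambda_0(A)$. -}

module Defs where

open import Data.Nat using (ℕ; suc; _+_; _≤_; _<_)
open import Data.Bool using (Bool; true; false)
open import Data.Fin.Subset using (Subset; _⊆_; _∩_; _∪_; _─_; ∣_∣; Nonempty; ⊥)
open import Data.Product using (_×_; Σ-syntax; ∃-syntax)
open import Data.Sum using (_⊎_)
open import Relation.Binary.PropositionalEquality using (_≡_)
open import Relation.Nullary using (¬_)

-- All ground sets are subsets of a common finite universe Fin N.
-- A connectivity system with ground set E ⊆ Fin N; λ is only meaningful on subsets of E.
record ConnSys (N : ℕ) : Set where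
  field
    E       : Subset N
    conn    : Subset N → ℕ
    sym     : ∀ X → X ⊆ E → conn X ≡ conn (E ─ X)
    submod  : ∀ X Y → X ⊆ E → Y ⊆ E →
              conn (X ∩ Y) + conn (X ∪ Y) ≤ conn X + conn Y
open ConnSys public

SetFamily : ℕ → Set
SetFamily N = Subset N → Bool

_∈F_ : ∀ {N} → Subset N → SetFamily N → Set
X ∈F 𝒯 = 𝒯 X ≡ true

InS : ∀ {N} → ConnSys N → ℕ → Subset N → Set
InS K k X = X ⊆ E K × conn K X < k

record IsTangle {N} (K : ConnSys N) (k : ℕ) (𝒯 : SetFamily N) : Set where
  field
    sub      : ∀ X → X ∈F 𝒯 → InS K k X
    exactly  : ∀ A → InS K k A →
               (A ∈F 𝒯 × ¬ ((E K ─ A) ∈F 𝒯)) ⊎ (¬ (A ∈F 𝒯) × (E K ─ A) ∈F 𝒯)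
    noCover  : ∀ T₁ T₂ T₃ → T₁ ∈F 𝒯 → T₂ ∈F 𝒯 → T₃ ∈F 𝒯 →
               ¬ ((T₁ ∪ T₂) ∪ T₃ ≡ E K)
    noBig    : ∀ X → X ∈F 𝒯 → ¬ (suc ∣ X ∣ ≡ ∣ E K ∣)

Dominates : ∀ {N} → ConnSys N → ConnSys N → Set
Dominates K K₀ = E K₀ ⊆ E K × (∀ X → X ⊆ E K₀ → conn K₀ X ≤ conn K X)

Induces : ∀ {N} → ConnSys N → ConnSys N → ℕ → SetFamily N → SetFamily N → Set
Induces K K₀ k 𝒯₀ 𝒯 = ∀ X → (X ∈F 𝒯 → InS K k X × (X ∩ E K₀) ∈F 𝒯₀)
                          × (InS K k X × (X ∩ E K₀) ∈F 𝒯₀ → X ∈F 𝒯)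

-- (X₁, X₂) is a partition of A (parts may be empty)
IsPartitionOf : ∀ {N} → Subset N → Subset N → Subset N → Set
IsPartitionOf X₁ X₂ A = X₁ ∪ X₂ ≡ A × X₁ ∩ X₂ ≡ ⊥

Adheres : ∀ {N} → ConnSys N → ConnSys N → Set
Adheres K₀ K = Dominates K K₀ ×
  (∀ A → A ⊆ E K₀ → Nonempty A → Nonempty (E K₀ ─ A) →
     ∃[ X₁ ] ∃[ X₂ ] ((IsPartitionOf X₁ X₂ A ⊎ IsPartitionOf X₁ X₂ (E K₀ ─ A))
                      × conn K X₁ ≤ conn K₀ A × conn K X₂ ≤ conn K₀ A))

Splits : ∀ {N} → ConnSys N → ConnSys N → ℕ → SetFamily N → Set
Splits K K₀ k 𝒯 = ∃[ 𝒯₁ ] ∃[ 𝒯₂ ] (IsTangle K₀ k 𝒯₁ × IsTangle K₀ k 𝒯₂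
                   × ¬ (∀ X → 𝒯₁ X ≡ 𝒯₂ X)
                   × Induces K K₀ k 𝒯₁ 𝒯 × Induces K K₀ k 𝒯₂ 𝒯)

-- Let tangles 𝒯₁, 𝒯₂ of K₀ induce the same 𝒯 in K. A set X ⊆ E₀ with λ(X) < k
-- lies in 𝒯₁ iff it lies in 𝒯 iff it lies in 𝒯₂. If A ∈ 𝒯₁ but B = E₀ ─ A ∈ 𝒯₂,
-- adhesion splits A (say) into X₁, X₂ with λ(Xᵢ) ≤ λ₀(A) < k; as λ₀-small subsets
-- of A ∈ 𝒯₁ they lie in 𝒯₁, hence in 𝒯₂, and then X₁, X₂, B ∈ 𝒯₂ cover E₀.
-- Splitting B instead is symmetric.
module Submission where

open import Defs hiding (sym)
open import Data.Bool using (true)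
open import Data.Bool.Properties using (⇔→≡) renaming (_≟_ to _≟ᵇ_)
open import Data.Empty using (⊥; ⊥-elim)
open import Data.Fin.Subset using (Subset; _⊆_; _∩_; _∪_; _─_; Empty)
open import Data.Fin.Subset.Properties
open import Data.Nat using (ℕ; _≥_; _<_)
open import Data.Nat.Properties using (≤-<-trans)
open import Data.Product using (_,_; proj₁; proj₂)
open import Data.Sum using (inj₁; inj₂)
open import Function.Bundles using (mk⇔)
open import Relation.Binary.PropositionalEquality using (_≡_; sym; trans; cong; subst)
open import Relation.Nullary using (¬_; yes; no)
open import Relation.Nullary.Decidable using (decidable-stable)

private
  variable
    n : ℕ

p⊆q⇒p∩q≡p : {p q : Subset n} → p ⊆ q → p ∩ q ≡ p
p⊆q⇒p∩q≡p {p = p} {q} p⊆q = ⊆-antisym (p∩q⊆p p q) (λ x∈p → x∈p∩q⁺ (x∈p , p⊆q x∈p))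

p⊆q⊆r⇒q∪r─p≡r : {p q r : Subset n} → p ⊆ q → q ⊆ r → q ∪ (r ─ p) ≡ r
p⊆q⊆r⇒q∪r─p≡r {p = p} {q} {r} p⊆q q⊆r = ⊆-antisym ⊆r r⊆
  where
  ⊆r : q ∪ (r ─ p) ⊆ r
  ⊆r x∈ with x∈p∪q⁻ q (r ─ p) x∈
  ... | inj₁ x∈q   = q⊆r x∈q
  ... | inj₂ x∈r─p = p─q⊆p r p x∈r─p
  r⊆ : r ⊆ q ∪ (r ─ p)
  r⊆ {x} x∈r with x ∈? p
  ... | yes x∈p = x∈p∪q⁺ (inj₁ (p⊆q x∈p))
  ... | no  x∉p = x∈p∪q⁺ (inj₂ (x∈p∧x∉q⇒x∈p─q x∈r x∉p))

p⊆q∧Empty[q─p]⇒p≡q : {p q : Subset n} → p ⊆ q → Empty (q ─ p) → p ≡ q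
p⊆q∧Empty[q─p]⇒p≡q {p = p} p⊆q q─p-empty = ⊆-antisym p⊆q q⊆p
  where
  q⊆p : _ ⊆ p
  q⊆p {x} x∈q with x ∈? p
  ... | yes x∈p = x∈p
  ... | no  x∉p = ⊥-elim (q─p-empty (x , x∈p∧x∉q⇒x∈p─q x∈q x∉p))

module _ {N} {K : ConnSys N} {k : ℕ} {𝒯 : SetFamily N} (tangle : IsTangle K k 𝒯) where
  open IsTangle tangle

  tangle-∌-E : ¬ (E K ∈F 𝒯)
  tangle-∌-E E∈𝒯 = noCover (E K) (E K) (E K) E∈𝒯 E∈𝒯 E∈𝒯
    (trans (cong (_∪ E K) (∪-idem (E K))) (∪-idem (E K)))

  tangle-⊆-closed : ∀ {P X} → P ∈F 𝒯 → X ⊆ P → conn K X < k → X ∈F 𝒯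
  tangle-⊆-closed {P} {X} P∈𝒯 X⊆P λX<k
    with P⊆E ← proj₁ (sub P P∈𝒯)
    with exactly X (⊆-trans X⊆P P⊆E , λX<k)
  ... | inj₁ (X∈𝒯 , _)   = X∈𝒯
  ... | inj₂ (_ , E─X∈𝒯) = ⊥-elim (noCover P P (E K ─ X) P∈𝒯 P∈𝒯 E─X∈𝒯
          (trans (cong (_∪ (E K ─ X)) (∪-idem P)) (p⊆q⊆r⇒q∪r─p≡r X⊆P P⊆E)))

module _ {N} {K K₀ : ConnSys N} {k : ℕ} {𝒯 : SetFamily N} where

  induced-∈-transfer : ∀ {𝒯₁ 𝒯₂} → E K₀ ⊆ E K →
                       Induces K K₀ k 𝒯₁ 𝒯 → Induces K K₀ k 𝒯₂ 𝒯 →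
                       ∀ {X} → X ⊆ E K₀ → conn K X < k → X ∈F 𝒯₁ → X ∈F 𝒯₂
  induced-∈-transfer {𝒯₁} {𝒯₂} E₀⊆E ind₁ ind₂ {X} X⊆E₀ λX<k X∈𝒯₁ =
    subst (_∈F 𝒯₂) X∩E₀≡X (proj₂ (proj₁ (ind₂ X) X∈𝒯))
    where
    X∩E₀≡X = p⊆q⇒p∩q≡p X⊆E₀
    X∈𝒯 : X ∈F 𝒯
    X∈𝒯 = proj₂ (ind₁ X) ((⊆-trans X⊆E₀ E₀⊆E , λX<k) , subst (_∈F 𝒯₁) (sym X∩E₀≡X) X∈𝒯₁)

  -- P and Q play the roles of A and E₀ ─ A, in either order.
  induced-tangles-no-small-split : ∀ {𝒯₁ 𝒯₂} →
    Dominates K K₀ → IsTangle K₀ k 𝒯₁ → IsTangle K₀ k 𝒯₂ →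
    Induces K K₀ k 𝒯₁ 𝒯 → Induces K K₀ k 𝒯₂ 𝒯 →
    ∀ {P Q X₁ X₂} → P ∈F 𝒯₁ → Q ∈F 𝒯₂ → P ∪ Q ≡ E K₀ → X₁ ∪ X₂ ≡ P →
    conn K X₁ < k → conn K X₂ < k → ⊥
  induced-tangles-no-small-split {𝒯₂ = 𝒯₂} (E₀⊆E , λ₀≤λ) t₁ t₂ ind₁ ind₂
      {P} {Q} {X₁} {X₂} P∈𝒯₁ Q∈𝒯₂ P∪Q≡E₀ X₁∪X₂≡P λX₁<k λX₂<k =
    IsTangle.noCover t₂ X₁ X₂ Q (part∈𝒯₂ X₁⊆P λX₁<k) (part∈𝒯₂ X₂⊆P λX₂<k) Q∈𝒯₂
      (trans (cong (_∪ Q) X₁∪X₂≡P) P∪Q≡E₀)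
    where
    P⊆E₀ = proj₁ (IsTangle.sub t₁ P P∈𝒯₁)
    X₁⊆P : X₁ ⊆ P
    X₁⊆P = subst (X₁ ⊆_) X₁∪X₂≡P (p⊆p∪q X₂)
    X₂⊆P : X₂ ⊆ P
    X₂⊆P = subst (X₂ ⊆_) X₁∪X₂≡P (q⊆p∪q X₁ X₂)
    part∈𝒯₂ : ∀ {X} → X ⊆ P → conn K X < k → X ∈F 𝒯₂
    part∈𝒯₂ {X} X⊆P λX<k = induced-∈-transfer E₀⊆E ind₁ ind₂ X⊆E₀ λX<k
      (tangle-⊆-closed t₁ P∈𝒯₁ X⊆P (≤-<-trans (λ₀≤λ X X⊆E₀) λX<k))
      where X⊆E₀ = ⊆-trans X⊆P P⊆E₀

  induced-tangles-⊆ : ∀ {𝒯₁ 𝒯₂} →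
                      Adheres K₀ K → IsTangle K₀ k 𝒯₁ → IsTangle K₀ k 𝒯₂ →
                      Induces K K₀ k 𝒯₁ 𝒯 → Induces K K₀ k 𝒯₂ 𝒯 →
                      ∀ A → A ∈F 𝒯₁ → A ∈F 𝒯₂
  induced-tangles-⊆ {𝒯₁} {𝒯₂} (dom , adh) t₁ t₂ ind₁ ind₂ A A∈𝒯₁ =
    decidable-stable (𝒯₂ A ≟ᵇ true) ¬A∉𝒯₂
    where
    E₀ = E K₀
    A∈𝒮 = IsTangle.sub t₁ A A∈𝒯₁
    A⊆E₀ = proj₁ A∈𝒮
    λ₀A<k = proj₂ A∈𝒮
    A∪B≡E₀ : A ∪ (E₀ ─ A) ≡ E₀
    A∪B≡E₀ = p⊆q⊆r⇒q∪r─p≡r ⊆-refl A⊆E₀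
    ¬A∉𝒯₂ : ¬ ¬ (A ∈F 𝒯₂)
    ¬A∉𝒯₂ A∉𝒯₂ with IsTangle.exactly t₂ A A∈𝒮
    ... | inj₁ (A∈𝒯₂ , _) = A∉𝒯₂ A∈𝒯₂
    ... | inj₂ (_ , B∈𝒯₂) with nonempty? A | nonempty? (E₀ ─ A)
    ... | no A-empty | _ = tangle-∌-E t₂ (subst (_∈F 𝒯₂) B≡E₀ B∈𝒯₂)
      where B≡E₀ = trans (cong (E₀ ─_) (Empty-unique A-empty)) (p─⊥≡p E₀)
    ... | yes _ | no B-empty =
      tangle-∌-E t₁ (subst (_∈F 𝒯₁) (p⊆q∧Empty[q─p]⇒p≡q A⊆E₀ B-empty) A∈𝒯₁)
    ... | yes A≠∅ | yes B≠∅ with adh A A⊆E₀ A≠∅ B≠∅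
    ... | X₁ , X₂ , inj₁ (X₁∪X₂≡A , _) , λX₁≤λ₀A , λX₂≤λ₀A =
      induced-tangles-no-small-split dom t₁ t₂ ind₁ ind₂ A∈𝒯₁ B∈𝒯₂ A∪B≡E₀ X₁∪X₂≡A
        (≤-<-trans λX₁≤λ₀A λ₀A<k) (≤-<-trans λX₂≤λ₀A λ₀A<k)
    ... | X₁ , X₂ , inj₂ (X₁∪X₂≡B , _) , λX₁≤λ₀A , λX₂≤λ₀A =
      induced-tangles-no-small-split dom t₂ t₁ ind₂ ind₁ B∈𝒯₂ A∈𝒯₁
        (trans (∪-comm (E₀ ─ A) A) A∪B≡E₀) X₁∪X₂≡B
        (≤-<-trans λX₁≤λ₀A λ₀A<k) (≤-<-trans λX₂≤λ₀A λ₀A<k)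

lemma2p1 : ∀ {N} (K K₀ : ConnSys N) → Adheres K₀ K →
    ∀ (k : ℕ) → k ≥ 1 → ∀ 𝒯 → IsTangle K k 𝒯 → ¬ Splits K K₀ k 𝒯
lemma2p1 K K₀ adheres k _ 𝒯 _ (𝒯₁ , 𝒯₂ , t₁ , t₂ , 𝒯₁≢𝒯₂ , ind₁ , ind₂) =
  𝒯₁≢𝒯₂ λ X → ⇔→≡ (mk⇔ (induced-tangles-⊆ {K = K} {𝒯 = 𝒯} adheres t₁ t₂ ind₁ ind₂ X)
                       (induced-tangles-⊆ {K = K} {𝒯 = 𝒯} adheres t₂ t₁ ind₂ ind₁ X))
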